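{- Fix an integer $k>0$, define $\tau,s:\mathbb{Z}_{>0}\to\mathbb{Z}_{>0}$ by $\tau(\ell)=\lceil k/\ell\rceil$ and $s(\ell)=\ell+\tau(\ell)+1$, and let $L=\max\{\ell\in\mathbb{Z}_{>0}:\ell\leq\tau(\ell)\}$. Then: (1) $L=\max\{\ell:\ell^2-\ell<k\}$; (2) $\tau$ is weakly decreasing, and so $s(\ell+1)\leq s(\ell)+1$ for all $\ell$; (3) the restriction of $\tau$ to $\{1,\ldots,L\}$ is strictly decreasing, and so $s$ is weakly decreasing on $\{1,\ldots,L\}$; (4) for all $\ell>L$, $\tau(\ell+1)\geq\tau(\ell)-1$, and so $s$ is weakly increasing on $\{L+1,L+2,\ldots\}$; (5) for all $\ell$, $\tau(\tau(\ell))\leq\ell$, and so $s(\tau(\ell))\leq s(\ell)$; (6) for all $\ell\leq L$, $\tau(\tau(\ell))=\ell$, and so $s(\tau(\ell))=s(\ell)$. -}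

module Defs where

open import Data.Nat using (ℕ; zero; suc; _+_; _*_; _∸_; _≤_; _<_; _/_)
open import Data.Product using (_×_)

-- ceiling division ⌈ k / ℓ ⌉ for ℓ ≥ 1 (value at ℓ = 0 is a junk 0, never used)
⌈_/_⌉ : ℕ → ℕ → ℕ
⌈ k / zero ⌉ = 0
⌈ k / suc m ⌉ = (k + m) / suc m

τ : ℕ → ℕ → ℕ
τ k ℓ = ⌈ k / ℓ ⌉

s : ℕ → ℕ → ℕ
s k ℓ = ℓ + τ k ℓ + 1

IsMaxPos : (ℕ → Set) → ℕ → Set
IsMaxPos P m = (1 ≤ m × P m) × (∀ n → 1 ≤ n → P n → n ≤ m)

-- Everything rests on the Galois connection of ceiling division: for ℓ ≥ 1,
--   τ(ℓ) ≤ t  ⇔  k ≤ t·ℓ,   equivalently   t < τ(ℓ)  ⇔  t·ℓ < k,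
-- together with the tightness bound τ(ℓ)·ℓ < k + ℓ.  From these we derive,
-- for an arbitrary k, the facts about τ: it is antitone, τ(τ(ℓ)) ≤ ℓ, and on
-- the "diagonal region" ℓ ≤ τ(ℓ) it is strictly decreasing and an involution
-- (both because τ(ℓ)·(ℓ-1) < k there); off the diagonal region it drops by at
-- most one per step.
-- The theorem then combines these, using that L ≤ τ(L) makes every ℓ ≤ L lie
-- in the diagonal region while maximality of L excludes every ℓ > L.
module Submission where

open import Defs
open import Data.Nat using (ℕ; zero; suc; _+_; _*_; _∸_; _≤_; _<_; _≤′_; ≤′-refl; ≤′-step; z≤n; s≤s; _≤?_)
open import Data.Nat.Properties
open import Data.Nat.DivMod using (_%_; m≡m%n+[m/n]*n; m%n<n; m/n*n≤m; m<n*o⇒m/o<n)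
open import Data.Product using (_×_; ∃; _,_; proj₁; proj₂)
open import Data.Sum using (inj₁; inj₂)
open import Data.Empty using (⊥-elim)
open import Function.Bundles using (_⇔_; mk⇔; Equivalence)
open import Relation.Nullary using (yes; no)
open import Relation.Unary using (Decidable)
open import Relation.Binary.PropositionalEquality using (_≡_; refl; sym; trans; cong; subst)

monotone-from-steps : (f : ℕ → ℕ) (lo : ℕ) →
  (∀ n → lo ≤ n → f n ≤ f (suc n)) →
  ∀ a b → lo ≤ a → a ≤ b → f a ≤ f b
monotone-from-steps f lo step a b lo≤a a≤b = go (≤⇒≤′ a≤b)
  where
  go : ∀ {c} → a ≤′ c → f a ≤ f c
  go ≤′-refl          = ≤-refl
  go (≤′-step {n} a≤n) = ≤-trans (go a≤n) (step n (≤-trans lo≤a (≤′⇒≤ a≤n)))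

antitone-from-steps : (f : ℕ → ℕ) (lo hi : ℕ) →
  (∀ n → lo ≤ n → suc n ≤ hi → f (suc n) ≤ f n) →
  ∀ a b → lo ≤ a → a ≤ b → b ≤ hi → f b ≤ f a
antitone-from-steps f lo hi step a b lo≤a a≤b b≤hi = go (≤⇒≤′ a≤b) b≤hi
  where
  go : ∀ {c} → a ≤′ c → c ≤ hi → f c ≤ f a
  go ≤′-refl          _     = ≤-refl
  go (≤′-step {n} a≤n) n<hi =
    ≤-trans (step n (≤-trans lo≤a (≤′⇒≤ a≤n)) n<hi) (go a≤n (≤-trans (n≤1+n n) n<hi))

greatest-up-to : {P : ℕ → Set} → Decidable P → P 1 → ∀ n →
  ∃ λ m → (1 ≤ m × P m) × (∀ j → 1 ≤ j → j ≤ n → P j → j ≤ m)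
greatest-up-to P? P1 zero = 1 , (≤-refl , P1) , λ j _ j≤0 _ → ≤-trans j≤0 z≤n
greatest-up-to {P} P? P1 (suc n) with P? (suc n) | greatest-up-to P? P1 n
... | yes Pn | _ = suc n , (s≤s z≤n , Pn) , λ j _ j≤n _ → j≤n
... | no ¬Pn | m , witness , below-n = m , witness , below-1+n
  where
  below-1+n : ∀ j → 1 ≤ j → j ≤ suc n → P j → j ≤ m
  below-1+n j 1≤j j≤1+n Pj with m≤n⇒m<n∨m≡n j≤1+n
  ... | inj₁ j<1+n = below-n j 1≤j (≤-pred j<1+n) Pj
  ... | inj₂ refl  = ⊥-elim (¬Pn Pj)

bounded-max : {P : ℕ → Set} → Decidable P → P 1 → (B : ℕ) →
  (∀ j → 1 ≤ j → P j → j ≤ B) → ∃ (IsMaxPos P)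
bounded-max P? P1 B bound with greatest-up-to P? P1 B
... | m , witness , below-B = m , witness , λ j 1≤j Pj → below-B j 1≤j (bound j 1≤j Pj) Pj

IsMaxPos-cong : {P Q : ℕ → Set} → (∀ n → 1 ≤ n → P n ⇔ Q n) →
  ∀ m → IsMaxPos P m → IsMaxPos Q m
IsMaxPos-cong P⇔Q m ((1≤m , Pm) , maxP) =
  (1≤m , Equivalence.to (P⇔Q m 1≤m) Pm) ,
  λ n 1≤n Qn → maxP n 1≤n (Equivalence.from (P⇔Q n 1≤n) Qn)

module _ (k : ℕ) where

  τ-covers : ∀ ℓ → 1 ≤ ℓ → k ≤ τ k ℓ * ℓ
  τ-covers (suc m) _ = +-cancelˡ-≤ m k (q * suc m) m+k≤m+qℓ
    where
    q : ℕ
    q = τ k (suc m)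
    m+k≤m+qℓ : m + k ≤ m + q * suc m
    m+k≤m+qℓ = begin
      m + k                          ≡⟨ +-comm m k ⟩
      k + m                          ≡⟨ m≡m%n+[m/n]*n (k + m) (suc m) ⟩
      (k + m) % suc m + q * suc m    ≤⟨ +-monoˡ-≤ (q * suc m) (≤-pred (m%n<n (k + m) (suc m))) ⟩
      m + q * suc m                  ∎
      where open ≤-Reasoning

  τ-tight : ∀ m → τ k (suc m) * suc m ≤ k + m
  τ-tight m = m/n*n≤m (k + m) (suc m)

  τ-least : ∀ ℓ t → 1 ≤ ℓ → k ≤ t * ℓ → τ k ℓ ≤ t
  τ-least (suc m) t _ k≤tℓ = ≤-pred (m<n*o⇒m/o<n k+m<[1+t]ℓ)
    where
    k+m<[1+t]ℓ : k + m < suc t * suc m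
    k+m<[1+t]ℓ = s≤s (≤-trans (+-monoˡ-≤ m k≤tℓ) (≤-reflexive (+-comm (t * suc m) m)))

  below-τ : ∀ ℓ t → 1 ≤ ℓ → t * ℓ < k → t < τ k ℓ
  below-τ ℓ t 1≤ℓ tℓ<k = ≰⇒> λ τ≤t → <⇒≱ tℓ<k (≤-trans (τ-covers ℓ 1≤ℓ) (*-monoˡ-≤ ℓ τ≤t))

  below-τ⁻¹ : ∀ ℓ t → 1 ≤ ℓ → t < τ k ℓ → t * ℓ < k
  below-τ⁻¹ ℓ t 1≤ℓ t<τ = ≰⇒> λ k≤tℓ → <⇒≱ t<τ (τ-least ℓ t 1≤ℓ k≤tℓ)

  τ-pos : 1 ≤ k → ∀ ℓ → 1 ≤ ℓ → 1 ≤ τ k ℓ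
  τ-pos 1≤k ℓ 1≤ℓ = below-τ ℓ 0 1≤ℓ 1≤k

  τ-antitone : ∀ a b → 1 ≤ a → a ≤ b → τ k b ≤ τ k a
  τ-antitone a b 1≤a a≤b =
    τ-least b (τ k a) (≤-trans 1≤a a≤b) (≤-trans (τ-covers a 1≤a) (*-monoʳ-≤ (τ k a) a≤b))

  -- τ(τ(ℓ)) ≤ ℓ (part (5)): ℓ itself satisfies k ≤ ℓ·τ(ℓ).
  τ-τ-≤ : 1 ≤ k → ∀ ℓ → 1 ≤ ℓ → τ k (τ k ℓ) ≤ ℓ
  τ-τ-≤ 1≤k ℓ 1≤ℓ =
    τ-least (τ k ℓ) ℓ (τ-pos 1≤k ℓ 1≤ℓ) (subst (k ≤_) (*-comm (τ k ℓ) ℓ) (τ-covers ℓ 1≤ℓ))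

  diagonal⇔ : ∀ ℓ → 1 ≤ ℓ → (ℓ ≤ τ k ℓ) ⇔ (ℓ * ℓ ∸ ℓ < k)
  diagonal⇔ (suc m) 1≤ℓ = mk⇔
    (λ ℓ≤τ → subst (_< k) (sym square-pred) (below-τ⁻¹ (suc m) m 1≤ℓ ℓ≤τ))
    (λ lt → below-τ (suc m) m 1≤ℓ (subst (_< k) square-pred lt))
    where
    square-pred : suc m * suc m ∸ suc m ≡ m * suc m
    square-pred = m+n∸m≡n (suc m) (m * suc m)

  -- The diagonal region is bounded by k, since there ℓ ≤ τ(ℓ) ≤ τ(1) ≤ k.
  diagonal-bounded : ∀ ℓ → 1 ≤ ℓ → ℓ ≤ τ k ℓ → ℓ ≤ k
  diagonal-bounded ℓ 1≤ℓ ℓ≤τ = ≤-trans ℓ≤τ (≤-trans (τ-antitone 1 ℓ ≤-refl 1≤ℓ)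
    (τ-least 1 k ≤-refl (≤-reflexive (sym (*-identityʳ k)))))

  -- On the diagonal region even τ(ℓ)·(ℓ-1) < k: by tightness
  -- τ(ℓ)·ℓ < k + ℓ, and removing one factor τ(ℓ) ≥ ℓ wins the slack.
  diagonal-slack : ∀ m → suc m ≤ τ k (suc m) → τ k (suc m) * m < k
  diagonal-slack m m<t = +-cancelˡ-< m (t * m) k (begin-strict
    m + t * m  <⟨ +-monoˡ-< (t * m) m<t ⟩
    t + t * m  ≡⟨ sym (*-suc t m) ⟩
    t * suc m  ≤⟨ τ-tight m ⟩
    k + m      ≡⟨ +-comm k m ⟩
    m + k      ∎)
    where
    open ≤-Reasoning
    t : ℕ
    t = τ k (suc m)

  -- If b is in the diagonal region then τ(b) < τ(a) for all a < b, since
  -- τ(b)·a ≤ τ(b)·(b-1) < k.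
  τ-strict-on-diagonal : ∀ a b → 1 ≤ a → a < b → b ≤ τ k b → τ k b < τ k a
  τ-strict-on-diagonal a (suc m) 1≤a (s≤s a≤m) b≤τ =
    below-τ a (τ k (suc m)) 1≤a (≤-<-trans (*-monoʳ-≤ (τ k (suc m)) a≤m) (diagonal-slack m b≤τ))

  τ-involutive-on-diagonal : 1 ≤ k → ∀ ℓ → 1 ≤ ℓ → ℓ ≤ τ k ℓ → τ k (τ k ℓ) ≡ ℓ
  τ-involutive-on-diagonal 1≤k (suc m) 1≤ℓ ℓ≤τ = ≤-antisym (τ-τ-≤ 1≤k (suc m) 1≤ℓ)
    (below-τ (τ k (suc m)) m (τ-pos 1≤k (suc m) 1≤ℓ)
      (subst (_< k) (*-comm (τ k (suc m)) m) (diagonal-slack m ℓ≤τ)))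

  τ-step-off-diagonal : ∀ ℓ → 1 ≤ ℓ → τ k (suc ℓ) ≤ ℓ → τ k ℓ ≤ τ k (suc ℓ) + 1
  τ-step-off-diagonal ℓ 1≤ℓ t≤ℓ = τ-least ℓ (t + 1) 1≤ℓ (begin
    k              ≤⟨ τ-covers (suc ℓ) (s≤s z≤n) ⟩
    t * suc ℓ      ≡⟨ *-suc t ℓ ⟩
    t + t * ℓ      ≤⟨ +-monoˡ-≤ (t * ℓ) t≤ℓ ⟩
    ℓ + t * ℓ      ≡⟨ cong (_* ℓ) (+-comm 1 t) ⟩
    (t + 1) * ℓ    ∎)
    where
    open ≤-Reasoning
    t : ℕ
    t = τ k (suc ℓ)

  s-step : ∀ ℓ → τ k (suc ℓ) ≤ τ k ℓ → s k (suc ℓ) ≤ s k ℓ + 1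
  s-step ℓ τ-le = +-monoˡ-≤ 1 (≤-trans (s≤s (+-monoʳ-≤ ℓ τ-le)) (≤-reflexive (+-comm 1 (ℓ + τ k ℓ))))

  s-step-down : ∀ ℓ → τ k (suc ℓ) < τ k ℓ → s k (suc ℓ) ≤ s k ℓ
  s-step-down ℓ τ-lt = +-monoˡ-≤ 1 (≤-trans (≤-reflexive (sym (+-suc ℓ (τ k (suc ℓ))))) (+-monoʳ-≤ ℓ τ-lt))

  s-step-up : ∀ ℓ → τ k ℓ ≤ τ k (suc ℓ) + 1 → s k ℓ ≤ s k (suc ℓ)
  s-step-up ℓ τ-le = +-monoˡ-≤ 1 (≤-trans (+-monoʳ-≤ ℓ τ-le)
    (≤-reflexive (trans (cong (ℓ +_) (+-comm (τ k (suc ℓ)) 1)) (+-suc ℓ (τ k (suc ℓ))))))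

  s-τ-≤ : ∀ ℓ → τ k (τ k ℓ) ≤ ℓ → s k (τ k ℓ) ≤ s k ℓ
  s-τ-≤ ℓ ττ≤ℓ = +-monoˡ-≤ 1 (≤-trans (+-monoʳ-≤ (τ k ℓ) ττ≤ℓ) (≤-reflexive (+-comm (τ k ℓ) ℓ)))

  s-τ-≡ : ∀ ℓ → τ k (τ k ℓ) ≡ ℓ → s k (τ k ℓ) ≡ s k ℓ
  s-τ-≡ ℓ ττ≡ℓ = cong (_+ 1) (trans (cong (τ k ℓ +_) ττ≡ℓ) (+-comm (τ k ℓ) ℓ))

  module _ (L : ℕ) (L-max : IsMaxPos (λ ℓ → ℓ ≤ τ k ℓ) L) where

    below-max-on-diagonal : ∀ ℓ → 1 ≤ ℓ → ℓ ≤ L → ℓ ≤ τ k ℓ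
    below-max-on-diagonal ℓ 1≤ℓ ℓ≤L =
      ≤-trans ℓ≤L (≤-trans (proj₂ (proj₁ L-max)) (τ-antitone ℓ L 1≤ℓ ℓ≤L))

    above-max-off-diagonal : ∀ ℓ → L < ℓ → τ k ℓ < ℓ
    above-max-off-diagonal ℓ L<ℓ =
      ≰⇒> λ ℓ≤τ → <⇒≱ L<ℓ (proj₂ L-max ℓ (≤-trans (s≤s z≤n) L<ℓ) ℓ≤τ)

    τ-strict-below-max : ∀ a b → 1 ≤ a → a < b → b ≤ L → τ k b < τ k a
    τ-strict-below-max a b 1≤a a<b b≤L =
      τ-strict-on-diagonal a b 1≤a a<b (below-max-on-diagonal b (≤-trans 1≤a (<⇒≤ a<b)) b≤L)

    τ-step-above-max : ∀ ℓ → L < ℓ → τ k ℓ ≤ τ k (suc ℓ) + 1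
    τ-step-above-max ℓ L<ℓ = τ-step-off-diagonal ℓ (≤-trans (s≤s z≤n) L<ℓ)
      (≤-pred (above-max-off-diagonal (suc ℓ) (m<n⇒m<1+n L<ℓ)))

lemma2p12 : (k : ℕ) → 1 ≤ k →
    ∃ (IsMaxPos (λ ℓ → ℓ ≤ τ k ℓ)) ×
    ((L : ℕ) → IsMaxPos (λ ℓ → ℓ ≤ τ k ℓ) L →
      IsMaxPos (λ ℓ → ℓ * ℓ ∸ ℓ < k) L ×
      (∀ a b → 1 ≤ a → a ≤ b → τ k b ≤ τ k a) ×
      (∀ ℓ → 1 ≤ ℓ → s k (suc ℓ) ≤ s k ℓ + 1) ×
      (∀ a b → 1 ≤ a → a < b → b ≤ L → τ k b < τ k a) ×
      (∀ a b → 1 ≤ a → a ≤ b → b ≤ L → s k b ≤ s k a) ×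
      (∀ ℓ → L < ℓ → τ k ℓ ≤ τ k (suc ℓ) + 1) ×
      (∀ a b → L < a → a ≤ b → s k a ≤ s k b) ×
      (∀ ℓ → 1 ≤ ℓ → τ k (τ k ℓ) ≤ ℓ) ×
      (∀ ℓ → 1 ≤ ℓ → s k (τ k ℓ) ≤ s k ℓ) ×
      (∀ ℓ → 1 ≤ ℓ → ℓ ≤ L → τ k (τ k ℓ) ≡ ℓ) ×
      (∀ ℓ → 1 ≤ ℓ → ℓ ≤ L → s k (τ k ℓ) ≡ s k ℓ))
lemma2p12 k 1≤k = L-exists , λ L L-max →
    IsMaxPos-cong (diagonal⇔ k) L L-max
  , τ-antitone k
  , (λ ℓ 1≤ℓ → s-step k ℓ (τ-antitone k ℓ (suc ℓ) 1≤ℓ (n≤1+n ℓ)))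
  , τ-strict-below-max k L L-max
  , antitone-from-steps (s k) 1 L (λ n 1≤n n<L →
      s-step-down k n (τ-strict-below-max k L L-max n (suc n) 1≤n (n<1+n n) n<L))
  , τ-step-above-max k L L-max
  , monotone-from-steps (s k) (suc L) (λ n L<n → s-step-up k n (τ-step-above-max k L L-max n L<n))
  , τ-τ-≤ k 1≤k
  , (λ ℓ 1≤ℓ → s-τ-≤ k ℓ (τ-τ-≤ k 1≤k ℓ 1≤ℓ))
  , (λ ℓ 1≤ℓ ℓ≤L → τ-involutive-on-diagonal k 1≤k ℓ 1≤ℓ (below-max-on-diagonal k L L-max ℓ 1≤ℓ ℓ≤L))
  , (λ ℓ 1≤ℓ ℓ≤L → s-τ-≡ k ℓ
      (τ-involutive-on-diagonal k 1≤k ℓ 1≤ℓ (below-max-on-diagonal k L L-max ℓ 1≤ℓ ℓ≤L)))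
  where
  -- L exists: the diagonal region contains 1 (τ(1) = k ≥ 1) and is bounded by k.
  L-exists : ∃ (IsMaxPos (λ ℓ → ℓ ≤ τ k ℓ))
  L-exists = bounded-max (λ ℓ → ℓ ≤? τ k ℓ) (τ-pos k 1≤k 1 ≤-refl) k (diagonal-bounded k)
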